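{- Let $c \geq 1$ be a constant. There exist a constant $\kappa > 0$ and a threshold $N$ such that for all integers $n, d \geq N$, every formula of fan-in at most $c$ that computes $\mathrm{OV}_{n,d}$ has size at least $$\kappa \cdot \min\left\{\frac{n^2}{\log d},\ \frac{n \cdot 2^d}{d^{1/2}\log d}\right\}.$$ (Equivalently: for all sufficiently large $n,d$, $\mathrm{OV}_{n,d}$ does not have fan-in-$c$ formulas of size $O(\min\{n^2/\log d,\ n 2^d/(d^{1/2}\log d)\})$.)
   Context: The Orthogonal Vectors function $\mathrm{OV}_{n,d}:\{0,1\}^{nd}\to\{0,1\}$ takes $n$ vectors $v_1,\ldots,v_n \in \{0,1\}^d$ (given as $nd$ Boolean input variables $v_{i,k}$) and outputs $1$ iff there exist indices $i,j$ with $\langle v_i, v_j\rangle = \sum_{k=1}^d v_{i,k}v_{j,k} = 0$. A formula of fan-in $c$ is a rooted tree whose leaves are labeled by input variables or constants and whose internal nodes (gates) compute arbitrary Boolean functions of at most $c$ inputs (i.e. any complete basis of gates of fan-in at most $c$); its size is its number of nodes. -}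

module Defs where

open import Data.Nat using (ℕ; zero; suc; _+_; _*_; _≤_; _≡ᵇ_)
open import Data.Bool using (Bool; true; false; _∧_; if_then_else_)
open import Data.Fin using (Fin; toℕ)
open import Data.Vec using (Vec; []; _∷_)
open import Data.List using (List; allFin; map)
open import Data.Nat.ListAction using (sum)
open import Data.Bool.ListAction using (any)
open import Data.Product using (_×_; _,_)
open import Relation.Binary.PropositionalEquality using (_≡_)

data Formula (X : Set) (c : ℕ) : Set where
  var   : X → Formula X c
  const : Bool → Formula X c
  gate  : (k : ℕ) → k ≤ c → (Vec Bool k → Bool) → Vec (Formula X c) k → Formula X c

mutual
  size : ∀ {X c} → Formula X c → ℕ
  size (var x)         = 1
  size (const b)       = 1
  size (gate k _ g fs) = suc (sizes fs)

  sizes : ∀ {X c k} → Vec (Formula X c) k → ℕ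
  sizes []       = 0
  sizes (f ∷ fs) = size f + sizes fs

mutual
  eval : ∀ {X c} → Formula X c → (X → Bool) → Bool
  eval (var x)         a = a x
  eval (const b)       a = b
  eval (gate k _ g fs) a = g (evals fs a)

  evals : ∀ {X c k} → Vec (Formula X c) k → (X → Bool) → Vec Bool k
  evals []       a = []
  evals (f ∷ fs) a = eval f a ∷ evals fs a

Computes : ∀ {X c} → Formula X c → ((X → Bool) → Bool) → Set
Computes F f = ∀ a → eval F a ≡ f a

OVInput : ℕ → ℕ → Set
OVInput n d = Fin n × Fin d

inner : ∀ {n d} → (OVInput n d → Bool) → Fin n → Fin n → ℕ
inner {n} {d} v i j =
  sum (map (λ k → if v (i , k) ∧ v (j , k) then 1 else 0) (allFin d))

OV : (n d : ℕ) → (OVInput n d → Bool) → Bool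
OV n d v = any (λ i → any (λ j → inner v i j ≡ᵇ 0) (allFin n)) (allFin n)

-- Nechiporuk's method, applied to the blocks formed by the rows of the input.  A
-- formula restricted by fixing every row but one computes, up to one of the four
-- functions Bool → Bool, one of K functions of the free row, where K grows by a factor
-- 2^(2^c) only at gates with at least two children reading that row; so K ≤ 2^O(2^c ℓ)
-- when ℓ leaves read the row.  If the other rows can be fixed in 2^t ways giving
-- pairwise distinct functions of the free row, then ℓ = Ω(t / 2^c), and summing over
-- the n rows gives size = Ω(n t / 2^c).  For OV, distinct words w_1, …, w_t of weight m
-- in {0,1}^(d-1) encode any S ⊆ {1, …, t}: the other rows are (1, w_a) for a ∈ S and
-- all-ones otherwise, and the free row (0, ¬w_a) is orthogonal to one of them iff a ∈ S.
-- Taking m = ⌊(d-1)/2⌋ and t = min(n - 1, C(d-1, m)), where C(d-1, m) ≳ 2^d / √d,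
-- gives the two regimes of the bound.

module Submission where

open import Defs
open import Data.Nat using (ℕ; _+_; _*_; _^_; _≤_; _<_)
open import Data.Nat.Logarithm using (⌊log₂_⌋)
open import Data.Product using (Σ; _×_; _,_)
open import Data.Sum using (_⊎_)

open import Data.Bool using (Bool; true; false; if_then_else_; not; _∧_; _∨_)
open import Data.Bool.ListAction using (any)
open import Data.Bool.Properties using (∨-identityʳ; ∧-comm)
open import Data.Fin as Fin
  using (Fin; toℕ; fromℕ<; inject≤; punchIn; punchOut; combine; quotient; remainder; splitAt; join; finToFun; funToFin; _≟_)
open import Data.Fin.Properties
  using ( remQuot-combine; combine-injective; injective⇒≤; 2↔Bool; join-splitAt; inject≤-injective; toℕ-injective
        ; toℕ-fromℕ<; toℕ-inject≤; toℕ<n; punchOut-cong; punchOut-punchIn; punchInᵢ≢i; funToFin-finToFin)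
open import Data.List as List using (allFin)
open import Data.List.Membership.Propositional using (_∈_)
open import Data.List.Membership.Propositional.Properties using (∈-allFin)
open import Data.List.Relation.Unary.Any using (here; there)
open import Data.Nat using (zero; suc; z≤n; s≤s; _⊓_; _≤?_; _<?_; _≡ᵇ_; NonZero; >-nonZero)
open import Data.Nat.ListAction using (sum)
open import Data.Nat.Logarithm using (⌊log₂⌋-mono-≤; ⌊log₂[2^n]⌋≡n)
open import Data.Nat.Properties hiding (_≟_)
open import Algebra.Properties.CommutativeMonoid.Sum +-0-commutativeMonoid using (∑-distrib-+) renaming (sum to ∑)
open import Data.Nat.Tactic.RingSolver using (solve-∀)
open import Data.Product using (Σ-syntax; proj₁; proj₂)
open import Data.Sum using (inj₁; inj₂)
import Data.Sum as Sum
open import Data.Vec using (Vec; []; _∷_; lookup; replicate; map; countᵇ)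
open import Data.Vec.Properties using (∷-injectiveˡ; ∷-injectiveʳ; lookup-map; lookup-replicate)
open import Function using (id; _∘_; Inverse)
open import Relation.Binary.PropositionalEquality
open import Relation.Nullary using (Dec; yes; no; does; contradiction)

quotient-combine : ∀ {m n} (i : Fin m) (j : Fin n) → quotient n (combine i j) ≡ i
quotient-combine i j = cong proj₁ (remQuot-combine i j)

remainder-combine : ∀ {m n} (i : Fin m) (j : Fin n) → remainder {m} n (combine i j) ≡ j
remainder-combine i j = cong proj₂ (remQuot-combine i j)

bit : Bool → Fin 2
bit = Inverse.from 2↔Bool

bit-injective : ∀ {a b} → bit a ≡ bit b → a ≡ b
bit-injective {false} {false} _ = refl
bit-injective {true}  {true}  _ = refl

or : ∀ {k} → Vec Bool k → Bool
or []       = false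
or (b ∷ bs) = b ∨ or bs

-- Shannon expansion: a function of k + 1 inputs is a pair of functions of k inputs.
#BoolFun : ℕ → ℕ
#BoolFun zero    = 2
#BoolFun (suc k) = #BoolFun k * #BoolFun k

boolFun : ∀ k → Fin (#BoolFun k) → Vec Bool k → Bool
boolFun zero    i []       = Inverse.to 2↔Bool i
boolFun (suc k) i (b ∷ bs) =
  if b then boolFun k (quotient (#BoolFun k) i) bs else boolFun k (remainder {#BoolFun k} (#BoolFun k) i) bs

boolFun-surjective : ∀ k (g : Vec Bool k → Bool) → Σ[ i ∈ Fin (#BoolFun k) ] (∀ bs → g bs ≡ boolFun k i bs)
boolFun-surjective zero g = bit (g []) , λ { [] → sym (Inverse.strictlyInverseˡ 2↔Bool (g [])) }
boolFun-surjective (suc k) g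
  with i₁ , g₁ ← boolFun-surjective k (g ∘ (true ∷_))
     | i₀ , g₀ ← boolFun-surjective k (g ∘ (false ∷_)) = combine i₁ i₀ , expand
  where
  expand : ∀ bs → g bs ≡ boolFun (suc k) (combine i₁ i₀) bs
  expand (true ∷ bs)  = trans (g₁ bs) (cong (λ i → boolFun k i bs) (sym (quotient-combine i₁ i₀)))
  expand (false ∷ bs) = trans (g₀ bs) (cong (λ i → boolFun k i bs) (sym (remainder-combine i₁ i₀)))

#BoolFun≡2^2^k : ∀ k → #BoolFun k ≡ 2 ^ 2 ^ k
#BoolFun≡2^2^k zero    = refl
#BoolFun≡2^2^k (suc k) = begin
  #BoolFun k * #BoolFun k    ≡⟨ cong₂ _*_ (#BoolFun≡2^2^k k) (#BoolFun≡2^2^k k) ⟩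
  2 ^ 2 ^ k * 2 ^ 2 ^ k      ≡⟨ ^-distribˡ-+-* 2 (2 ^ k) (2 ^ k) ⟨
  2 ^ (2 ^ k + 2 ^ k)        ≡⟨ cong (λ x → 2 ^ (2 ^ k + x)) (+-identityʳ (2 ^ k)) ⟨
  2 ^ 2 ^ suc k              ∎
  where open ≡-Reasoning

#BoolFun-mono : ∀ {k c} → k ≤ c → #BoolFun k ≤ #BoolFun c
#BoolFun-mono {k} {c} k≤c =
  subst₂ _≤_ (sym (#BoolFun≡2^2^k k)) (sym (#BoolFun≡2^2^k c)) (^-monoʳ-≤ 2 (^-monoʳ-≤ 2 k≤c))

#BoolFun>0 : ∀ k → 0 < #BoolFun k
#BoolFun>0 k = subst (0 <_) (sym (#BoolFun≡2^2^k k)) (m^n>0 2 (2 ^ k))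

*-^-bound-combine : ∀ x K₁ K₂ a b u v → K₁ * x ^ a ≤ x ^ u → K₂ * x ^ b ≤ x ^ v →
                    (K₁ * K₂) * x ^ (a + b) ≤ x ^ (u + v)
*-^-bound-combine x K₁ K₂ a b u v bound₁ bound₂ = begin
  (K₁ * K₂) * x ^ (a + b)       ≡⟨ cong ((K₁ * K₂) *_) (^-distribˡ-+-* x a b) ⟩
  (K₁ * K₂) * (x ^ a * x ^ b)   ≡⟨ [m*n]*[o*p]≡[m*o]*[n*p] K₁ K₂ (x ^ a) (x ^ b) ⟩
  (K₁ * x ^ a) * (K₂ * x ^ b)   ≤⟨ *-mono-≤ bound₁ bound₂ ⟩
  x ^ u * x ^ v                 ≡⟨ ^-distribˡ-+-* x u v ⟨
  x ^ (u + v)                   ∎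
  where open ≤-Reasoning

-- Nechiporuk's method for one block of variables.  A restriction ρ fixes the
-- variables outside the block; the block itself is read from y : Y.
module Nechiporuk {X Y : Set} (inBlock : X → Bool) (select : X → Y → Bool) (c : ℕ) where

  A : ℕ
  A = #BoolFun c

  plug : (X → Bool) → Y → X → Bool
  plug ρ y x = if inBlock x then select x y else ρ x

  mutual
    blockLeaves : Formula X c → ℕ
    blockLeaves (var x)           = if inBlock x then 1 else 0
    blockLeaves (const b)         = 0
    blockLeaves (gate k _ g fs)   = blockLeavesᵛ fs

    blockLeavesᵛ : ∀ {k} → Vec (Formula X c) k → ℕ
    blockLeavesᵛ []       = 0
    blockLeavesᵛ (f ∷ fs) = blockLeaves f + blockLeavesᵛ fs

  liveChildren : ∀ {k} → Vec (Formula X c) k → ℕ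
  liveChildren []       = 0
  liveChildren (f ∷ fs) = 1 ⊓ blockLeaves f + liveChildren fs

  -- The factor A ^ (1 ⊓ ℓ) in the bound on K is the slack that pays for the choice
  -- of gate function at every gate with at least two children seeing the block.
  record Decomposition (F : Formula X c) : Set where
    field
      K       : ℕ
      branch  : Fin K → Y → Bool
      few     : K * A ^ (1 ⊓ blockLeaves F) ≤ A ^ (2 * blockLeaves F)
      blind   : blockLeaves F ≡ 0 → ∀ i y → branch i y ≡ false
      factors : ∀ ρ → Σ[ i ∈ Fin K ] Σ[ φ ∈ (Bool → Bool) ] (∀ y → eval F (plug ρ y) ≡ φ (branch i y))

  record Decompositionᵛ {k} (fs : Vec (Formula X c) k) : Set where
    field
      K        : ℕ
      branches : Fin K → Y → Vec Bool k
      few      : K * A ^ liveChildren fs ≤ A ^ (2 * blockLeavesᵛ fs)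
      blind    : blockLeavesᵛ fs ≡ 0 → ∀ i y → or (branches i y) ≡ false
      -- With at most one child seeing the block, all other branches are constantly
      -- false, so the children's values depend on a single bit.
      factors  : ∀ ρ → Σ[ i ∈ Fin K ] Σ[ Ψ ∈ (Vec Bool k → Vec Bool k) ]
        (∀ y → evals fs (plug ρ y) ≡ Ψ (branches i y)) ×
        (liveChildren fs ≤ 1 → Σ[ ψ ∈ (Bool → Vec Bool k) ] (∀ y → evals fs (plug ρ y) ≡ ψ (or (branches i y))))

  plug-inside : ∀ ρ y {x} → inBlock x ≡ true → plug ρ y x ≡ select x y
  plug-inside ρ y eq rewrite eq = refl

  plug-outside : ∀ ρ y {x} → inBlock x ≡ false → plug ρ y x ≡ ρ x
  plug-outside ρ y eq rewrite eq = refl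

  1⊓blockLeavesᵛ≤liveChildren : ∀ {k} (fs : Vec (Formula X c) k) → 1 ⊓ blockLeavesᵛ fs ≤ liveChildren fs
  1⊓blockLeavesᵛ≤liveChildren []       = z≤n
  1⊓blockLeavesᵛ≤liveChildren (f ∷ fs) with blockLeaves f
  ... | zero  = 1⊓blockLeavesᵛ≤liveChildren fs
  ... | suc _ = s≤s z≤n

  liveChildren≤blockLeavesᵛ : ∀ {k} (fs : Vec (Formula X c) k) → liveChildren fs ≤ blockLeavesᵛ fs
  liveChildren≤blockLeavesᵛ []       = z≤n
  liveChildren≤blockLeavesᵛ (f ∷ fs) = +-mono-≤ (m⊓n≤n 1 (blockLeaves f)) (liveChildren≤blockLeavesᵛ fs)

  blockLeavesᵛ≡0 : ∀ {k} (fs : Vec (Formula X c) k) → liveChildren fs ≡ 0 → blockLeavesᵛ fs ≡ 0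
  blockLeavesᵛ≡0 []       _ = refl
  blockLeavesᵛ≡0 (f ∷ fs) e with blockLeaves f
  ... | zero = blockLeavesᵛ≡0 fs e

  instance
    A-nonZero : NonZero A
    A-nonZero = >-nonZero (#BoolFun>0 c)

  decomposeVar : ∀ x b → inBlock x ≡ b → Decomposition (var x)
  decomposeVar x true x∈block = record
    { K       = 1
    ; branch  = λ _ → select x
    ; few     = subst (λ l → 1 * A ^ (1 ⊓ l) ≤ A ^ (2 * l)) (sym leaves≡1)
                  (≤-trans (≤-reflexive (*-identityˡ (A ^ 1))) (^-monoʳ-≤ A {1} {2} (s≤s z≤n)))
    ; blind   = λ leaves≡0 → contradiction (trans (sym leaves≡1) leaves≡0) λ ()
    ; factors = λ ρ → Fin.zero , id , λ y → plug-inside ρ y x∈block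
    }
    where
    leaves≡1 : blockLeaves (var x) ≡ 1
    leaves≡1 = cong (if_then 1 else 0) x∈block
  decomposeVar x false x∉block = record
    { K       = 1
    ; branch  = λ _ _ → false
    ; few     = subst (λ l → 1 * A ^ (1 ⊓ l) ≤ A ^ (2 * l)) (sym leaves≡0) ≤-refl
    ; blind   = λ _ _ _ → refl
    ; factors = λ ρ → Fin.zero , (λ _ → ρ x) , λ y → plug-outside ρ y x∉block
    }
    where
    leaves≡0 : blockLeaves (var x) ≡ 0
    leaves≡0 = cong (if_then 1 else 0) x∉block

  decomposeConst : ∀ b → Decomposition (const b)
  decomposeConst b = record
    { K       = 1
    ; branch  = λ _ _ → false
    ; few     = ≤-refl
    ; blind   = λ _ _ _ → refl
    ; factors = λ ρ → Fin.zero , (λ _ → b) , λ _ → refl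
    }

  decomposeThin : ∀ {k} {k≤c : k ≤ c} (g : Vec Bool k → Bool) (fs : Vec (Formula X c) k) →
                  Decompositionᵛ fs → liveChildren fs ≤ 1 → Decomposition (gate k k≤c g fs)
  decomposeThin g fs D thin = record
    { K       = K
    ; branch  = λ i y → or (branches i y)
    ; few     = ≤-trans (*-monoʳ-≤ K (^-monoʳ-≤ A (1⊓blockLeavesᵛ≤liveChildren fs))) few
    ; blind   = blind
    ; factors = collapse
    }
    where
    open Decompositionᵛ D
    collapse : ∀ ρ → Σ[ i ∈ Fin K ] Σ[ φ ∈ (Bool → Bool) ] (∀ y → g (evals fs (plug ρ y)) ≡ φ (or (branches i y)))
    collapse ρ =
      let i , _ , _ , single = factors ρ
          ψ , eq             = single thin
      in  i , g ∘ ψ , cong g ∘ eq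

  decomposeBranching : ∀ {k} (k≤c : k ≤ c) (g : Vec Bool k → Bool) (fs : Vec (Formula X c) k) →
                       Decompositionᵛ fs → 2 ≤ liveChildren fs → Decomposition (gate k k≤c g fs)
  decomposeBranching {k} k≤c g fs D branching = record
    { K       = #BoolFun k * K
    ; branch  = branch
    ; few     = few′
    ; blind   = λ L≡0 → contradiction (≤-trans branching (≤-trans (liveChildren≤blockLeavesᵛ fs) (≤-reflexive L≡0))) λ ()
    ; factors = factors′
    }
    where
    open Decompositionᵛ D
    L = blockLeavesᵛ fs

    branch : Fin (#BoolFun k * K) → Y → Bool
    branch n y = boolFun k (quotient K n) (branches (remainder {#BoolFun k} K n) y)

    few′ : (#BoolFun k * K) * A ^ (1 ⊓ L) ≤ A ^ (2 * L)
    few′ = begin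
      (#BoolFun k * K) * A ^ (1 ⊓ L) ≤⟨ *-mono-≤ (*-monoˡ-≤ K (#BoolFun-mono k≤c)) (^-monoʳ-≤ A (m⊓n≤m 1 L)) ⟩
      (A * K) * A ^ 1                ≡⟨ reorder A K ⟩
      K * A ^ 2                      ≤⟨ *-monoʳ-≤ K (^-monoʳ-≤ A branching) ⟩
      K * A ^ liveChildren fs        ≤⟨ few ⟩
      A ^ (2 * L)                    ∎
      where
      open ≤-Reasoning
      reorder : ∀ a b → (a * b) * (a * 1) ≡ b * (a * (a * 1))
      reorder = solve-∀

    factors′ : ∀ ρ → Σ[ n ∈ Fin (#BoolFun k * K) ] Σ[ φ ∈ (Bool → Bool) ] (∀ y → g (evals fs (plug ρ y)) ≡ φ (branch n y))
    factors′ ρ with i , Ψ , eq , _ ← factors ρ with j , gΨ≡ ← boolFun-surjective k (g ∘ Ψ) = combine j i , id , λ y → begin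
      g (evals fs (plug ρ y))         ≡⟨ cong g (eq y) ⟩
      g (Ψ (branches i y))            ≡⟨ gΨ≡ (branches i y) ⟩
      boolFun k j (branches i y)      ≡⟨ cong₂ (λ j′ i′ → boolFun k j′ (branches i′ y)) (quotient-combine j i) (remainder-combine j i) ⟨
      branch (combine j i) y          ∎
      where open ≡-Reasoning

  decompose-[] : Decompositionᵛ []
  decompose-[] = record
    { K        = 1
    ; branches = λ _ _ → []
    ; few      = ≤-refl
    ; blind    = λ _ _ _ → refl
    ; factors  = λ ρ → Fin.zero , id , (λ _ → refl) , λ _ → (λ _ → []) , λ _ → refl
    }

  decompose-∷ : ∀ {k} (f : Formula X c) (fs : Vec (Formula X c) k) →
                Decomposition f → Decompositionᵛ fs → Decompositionᵛ (f ∷ fs)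
  decompose-∷ {k} f fs D E = record
    { K        = D.K * E.K
    ; branches = branches
    ; few      = subst (λ e → (D.K * E.K) * A ^ liveChildren (f ∷ fs) ≤ A ^ e) (sym (*-distribˡ-+ 2 l L))
                   (*-^-bound-combine A D.K E.K (1 ⊓ l) (liveChildren fs) (2 * l) (2 * L) D.few E.few)
    ; blind    = λ l+L≡0 _ y → cong₂ _∨_ (D.blind (m+n≡0⇒m≡0 _ l+L≡0) _ y) (E.blind (m+n≡0⇒n≡0 _ l+L≡0) _ y)
    ; factors  = factors
    }
    where
    module D = Decomposition D
    module E = Decompositionᵛ E
    l = blockLeaves f
    L = blockLeavesᵛ fs

    branches : Fin (D.K * E.K) → Y → Vec Bool (suc k)
    branches n y = D.branch (quotient E.K n) y ∷ E.branches (remainder {D.K} E.K n) y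

    branches-combine : ∀ i j y → branches (combine i j) y ≡ D.branch i y ∷ E.branches j y
    branches-combine i j y =
      cong₂ (λ i′ j′ → D.branch i′ y ∷ E.branches j′ y) (quotient-combine i j) (remainder-combine i j)

    factors : ∀ ρ → Σ[ n ∈ Fin (D.K * E.K) ] Σ[ Ψ ∈ (Vec Bool (suc k) → Vec Bool (suc k)) ]
      (∀ y → evals (f ∷ fs) (plug ρ y) ≡ Ψ (branches n y)) ×
      (liveChildren (f ∷ fs) ≤ 1 → Σ[ ψ ∈ (Bool → Vec Bool (suc k)) ] (∀ y → evals (f ∷ fs) (plug ρ y) ≡ ψ (or (branches n y))))
    factors ρ with i , φ , eq₁ ← D.factors ρ | j , Ψ , eq₂ , single ← E.factors ρ =
      combine i j , Ψ′ , (λ y → trans (cong₂ _∷_ (eq₁ y) (eq₂ y)) (cong Ψ′ (sym (branches-combine i j y)))) , single′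
      where
      Ψ′ : Vec Bool (suc k) → Vec Bool (suc k)
      Ψ′ (b ∷ bs) = φ b ∷ Ψ bs

      or-branches : ∀ y → or (branches (combine i j) y) ≡ D.branch i y ∨ or (E.branches j y)
      or-branches y = cong or (branches-combine i j y)

      single′ : liveChildren (f ∷ fs) ≤ 1 →
                Σ[ ψ ∈ (Bool → Vec Bool (suc k)) ] (∀ y → evals (f ∷ fs) (plug ρ y) ≡ ψ (or (branches (combine i j) y)))
      single′ thin with blockLeaves f in leaves-f
      single′ thin | zero with ψ , eq ← single thin = (λ b → φ false ∷ ψ b) , λ y →
        cong₂ _∷_ (trans (eq₁ y) (cong φ (D.blind leaves-f i y)))
                  (trans (eq y) (cong ψ (sym (trans (or-branches y) (cong (_∨ or (E.branches j y)) (D.blind leaves-f i y))))))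
      single′ (s≤s none) | suc _ with ψ , eq ← single (≤-trans none z≤n) = (λ b → φ b ∷ ψ false) , λ y →
        cong₂ _∷_ (trans (eq₁ y) (cong φ (sym (trans (or-branches y) (trans (cong (D.branch i y ∨_) (tail-blind y)) (∨-identityʳ _))))))
                  (trans (eq y) (cong ψ (tail-blind y)))
        where
        tail-blind : ∀ y → or (E.branches j y) ≡ false
        tail-blind = E.blind (blockLeavesᵛ≡0 fs (n≤0⇒n≡0 none)) j

  mutual
    decompose : (F : Formula X c) → Decomposition F
    decompose (var x)           = decomposeVar x (inBlock x) refl
    decompose (const b)         = decomposeConst b
    decompose (gate k k≤c g fs) with liveChildren fs ≤? 1
    ... | yes thin = decomposeThin g fs (decomposeᵛ fs) thin
    ... | no ¬thin = decomposeBranching k≤c g fs (decomposeᵛ fs) (≰⇒> ¬thin)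

    decomposeᵛ : ∀ {k} (fs : Vec (Formula X c) k) → Decompositionᵛ fs
    decomposeᵛ []       = decompose-[]
    decomposeᵛ (f ∷ fs) = decompose-∷ f fs (decompose f) (decomposeᵛ fs)

  distinctSubfunctions≤ : (F : Formula X c) {T : ℕ} (ρ : Fin T → X → Bool) →
    (∀ s t → (∀ y → eval F (plug (ρ s) y) ≡ eval F (plug (ρ t) y)) → s ≡ t) →
    T ≤ 4 * A ^ (2 * blockLeaves F)
  distinctSubfunctions≤ F {T} ρ distinct = ≤-trans (injective⇒≤ code-injective) (*-monoʳ-≤ 4 K≤)
    where
    open Decomposition (decompose F)

    code : Fin T → Fin (4 * K)
    code s = let i , φ , _ = factors (ρ s) in combine (combine (bit (φ false)) (bit (φ true))) i

    code-injective : ∀ {s t} → code s ≡ code t → s ≡ t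
    code-injective {s} {t} codes≡ with factors (ρ s) | factors (ρ t)
    ... | i , φ , eval≡φ | j , χ , eval≡χ
      with φs≡χs , refl ← combine-injective (combine (bit (φ false)) (bit (φ true))) i
                                            (combine (bit (χ false)) (bit (χ true))) j codes≡
      with φ₀≡χ₀ , φ₁≡χ₁ ← combine-injective _ _ _ _ φs≡χs =
      distinct s t λ y → trans (eval≡φ y) (trans (φ≗χ (branch i y)) (sym (eval≡χ y)))
      where
      φ≗χ : ∀ b → φ b ≡ χ b
      φ≗χ false = bit-injective φ₀≡χ₀
      φ≗χ true  = bit-injective φ₁≡χ₁

    K≤ : K ≤ A ^ (2 * blockLeaves F)
    K≤ = ≤-trans (m≤m*n K (A ^ (1 ⊓ blockLeaves F)) {{m^n≢0 A (1 ⊓ blockLeaves F)}}) few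

-- Pascal's recursion, so that Fin (choose (1 + n) (1 + k)) splits along splitAt (see layer).
choose : ℕ → ℕ → ℕ
choose _       zero    = 1
choose zero    (suc k) = 0
choose (suc n) (suc k) = choose n k + choose n (suc k)

choose[n,1]≡n : ∀ n → choose n 1 ≡ n
choose[n,1]≡n zero    = refl
choose[n,1]≡n (suc n) = cong suc (choose[n,1]≡n n)

choose-absorb : ∀ n k → suc k * choose (suc n) (suc k) ≡ suc n * choose n k
choose-absorb n zero = begin
  1 * choose (suc n) 1  ≡⟨ *-identityˡ _ ⟩
  choose (suc n) 1      ≡⟨ choose[n,1]≡n (suc n) ⟩
  suc n                 ≡⟨ *-identityʳ (suc n) ⟨
  suc n * 1             ∎
  where open ≡-Reasoning
choose-absorb zero    (suc k) = *-zeroʳ (suc (suc k))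
choose-absorb (suc n) (suc k) = begin
  suc (suc k) * (X + Y)                        ≡⟨ expand k X Y ⟩
  X + suc k * X + suc (suc k) * Y              ≡⟨ cong₂ (λ u v → X + u + v) (choose-absorb n k) (choose-absorb n (suc k)) ⟩
  X + suc n * choose n k + suc n * choose n (suc k) ≡⟨ collect n (choose n k) (choose n (suc k)) ⟩
  suc (suc n) * X                              ∎
  where
  open ≡-Reasoning
  X = choose (suc n) (suc k)
  Y = choose (suc n) (suc (suc k))
  expand : ∀ k x y → suc (suc k) * (x + y) ≡ x + suc k * x + suc (suc k) * y
  expand = solve-∀
  collect : ∀ n a b → (a + b) + suc n * a + suc n * b ≡ suc (suc n) * (a + b)
  collect = solve-∀

central : ℕ → ℕ
central m = choose (m + m) m

central-step : ∀ m → suc m * central (suc m) ≡ 2 * (suc (m + m) * central m)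
central-step m = begin
  suc m * choose (suc m + suc m) (suc m) ≡⟨ cong (λ z → suc m * choose (suc z) (suc m)) (+-suc m m) ⟩
  suc m * (X + Y)                        ≡⟨ cong (λ z → suc m * (z + Y)) X≡Y ⟩
  suc m * (Y + Y)                        ≡⟨ double (suc m) Y ⟩
  2 * (suc m * Y)                        ≡⟨ cong (2 *_) (choose-absorb (m + m) m) ⟩
  2 * (suc (m + m) * central m)          ∎
  where
  open ≡-Reasoning
  X = choose (suc (m + m)) m
  Y = choose (suc (m + m)) (suc m)
  double : ∀ a y → a * (y + y) ≡ 2 * (a * y)
  double = solve-∀
  split : ∀ m x → suc (suc (m + m)) * x ≡ suc m * x + suc m * x
  split = solve-∀
  -- symmetry of the middle row, read off from the absorption identity
  X≡Y : X ≡ Y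
  X≡Y = sym (*-cancelˡ-≡ Y X (suc m) (+-cancelˡ-≡ (suc m * X) _ _ (begin
    suc m * X + suc m * Y   ≡⟨ *-distribˡ-+ (suc m) X Y ⟨
    suc m * (X + Y)         ≡⟨ choose-absorb (suc (m + m)) m ⟩
    suc (suc (m + m)) * X   ≡⟨ split m X ⟩
    suc m * X + suc m * X   ∎)))

-- By induction: C(2m+2,m+1) / C(2m,m) = 2(2m+1)/(m+1), and (2m+1)² ≥ 4m(m+1).
central-lower-bound : ∀ m → 4 ^ (suc m + suc m) ≤ 4 * suc m * (central (suc m) * central (suc m))
central-lower-bound zero    = ≤-refl
central-lower-bound (suc m) = *-cancelʳ-≤ _ _ (a′ * a′) main
  where
  a  = suc m
  a′ = suc a
  B  = central a
  B′ = central a′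
  s  = suc (a + a)
  open ≤-Reasoning
  16-step : 4 ^ (a′ + a′) ≡ 16 * 4 ^ (a + a)
  16-step = begin-equality
    4 ^ (a′ + a′)           ≡⟨ cong (λ z → 4 ^ suc z) (+-suc a a) ⟩
    4 * (4 * 4 ^ (a + a))   ≡⟨ *-assoc 4 4 (4 ^ (a + a)) ⟨
    16 * 4 ^ (a + a)        ∎
  4aa′≤s² : 4 * a * a′ ≤ s * s
  4aa′≤s² = ≤-trans (n≤1+n _) (≤-reflexive (square a))
    where
    square : ∀ a → suc (4 * a * suc a) ≡ suc (a + a) * suc (a + a)
    square = solve-∀
  rearrange₁ : ∀ a B → 16 * (4 * a * (B * B)) * (suc a * suc a) ≡ (16 * suc a * (B * B)) * (4 * a * suc a)
  rearrange₁ = solve-∀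
  rearrange₂ : ∀ a′ B s → (16 * a′ * (B * B)) * (s * s) ≡ 4 * a′ * ((2 * (s * B)) * (2 * (s * B)))
  rearrange₂ = solve-∀
  rearrange₃ : ∀ a′ B′ → 4 * a′ * ((a′ * B′) * (a′ * B′)) ≡ 4 * a′ * (B′ * B′) * (a′ * a′)
  rearrange₃ = solve-∀
  main : 4 ^ (a′ + a′) * (a′ * a′) ≤ 4 * a′ * (B′ * B′) * (a′ * a′)
  main = begin
    4 ^ (a′ + a′) * (a′ * a′)                    ≡⟨ cong (_* (a′ * a′)) 16-step ⟩
    16 * 4 ^ (a + a) * (a′ * a′)                 ≤⟨ *-monoˡ-≤ (a′ * a′) (*-monoʳ-≤ 16 (central-lower-bound m)) ⟩
    16 * (4 * a * (B * B)) * (a′ * a′)           ≡⟨ rearrange₁ a B ⟩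
    (16 * a′ * (B * B)) * (4 * a * a′)           ≤⟨ *-monoʳ-≤ (16 * a′ * (B * B)) 4aa′≤s² ⟩
    (16 * a′ * (B * B)) * (s * s)                ≡⟨ rearrange₂ a′ B s ⟩
    4 * a′ * ((2 * (s * B)) * (2 * (s * B)))     ≡⟨ cong (λ z → 4 * a′ * (z * z)) (central-step a) ⟨
    4 * a′ * ((a′ * B′) * (a′ * B′))             ≡⟨ rearrange₃ a′ B′ ⟩
    4 * a′ * (B′ * B′) * (a′ * a′)               ∎

choose>0 : ∀ {n k} → k ≤ n → 0 < choose n k
choose>0 {k = zero}          _         = s≤s z≤n
choose>0 {suc n} {suc k} (s≤s k≤n) = ≤-trans (choose>0 k≤n) (m≤m+n _ _)

n≤choose[n,1+k] : ∀ {n k} → suc k < n → n ≤ choose n (suc k)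
n≤choose[n,1+k] {suc n} {zero}  _         = ≤-reflexive (cong suc (sym (choose[n,1]≡n n)))
n≤choose[n,1+k] {suc n} {suc k} (s≤s k<n) =
  ≤-trans (≤-reflexive (+-comm 1 n)) (+-mono-≤ (n≤choose[n,1+k] k<n) (choose>0 k<n))

even-or-odd : ∀ n → Σ[ m ∈ ℕ ] (n ≡ m + m ⊎ n ≡ suc (m + m))
even-or-odd zero = 0 , inj₁ refl
even-or-odd (suc n) with even-or-odd n
... | m , inj₁ refl = m , inj₂ refl
... | m , inj₂ refl = suc m , inj₁ (cong suc (sym (+-suc m m)))

middle-binomial : ∀ D → 2 ≤ D →
  Σ[ m ∈ ℕ ] m < D × D ≤ choose D m × 4 ^ suc D ≤ 32 * suc D * (choose D m * choose D m)
middle-binomial D 2≤D with even-or-odd D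
... | zero , inj₁ refl = contradiction 2≤D λ ()
... | zero , inj₂ refl = contradiction 2≤D λ { (s≤s ()) }
... | suc m , inj₁ refl = suc m , m<D , n≤choose[n,1+k] m<D , bound
  where
  m<D : suc m < D
  m<D = s≤s (m≤n+m (suc m) m)
  C = central (suc m)
  bound : 4 ^ suc D ≤ 32 * suc D * (C * C)
  bound = begin
    4 * 4 ^ D                   ≤⟨ *-monoʳ-≤ 4 (central-lower-bound m) ⟩
    4 * (4 * suc m * (C * C))   ≡⟨ regroup m (C * C) ⟩
    16 * suc m * (C * C)        ≤⟨ *-monoˡ-≤ (C * C) (≤-trans (m≤m+n (16 * suc m) (48 * m + 80)) (≤-reflexive (enlarge m))) ⟩
    32 * suc D * (C * C)        ∎
    where
    open ≤-Reasoning
    regroup : ∀ m x → 4 * (4 * suc m * x) ≡ 16 * suc m * x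
    regroup = solve-∀
    enlarge : ∀ m → 16 * suc m + (48 * m + 80) ≡ 32 * suc (suc m + suc m)
    enlarge = solve-∀
... | suc m , inj₂ refl = suc m , m<D , n≤choose[n,1+k] m<D , bound
  where
  m<D : suc m < D
  m<D = s≤s (≤-trans (m≤n+m (suc m) m) (n≤1+n _))
  B = central (suc m)
  C = choose D (suc m)
  B≤C : B ≤ C
  B≤C = m≤n+m B (choose (suc m + suc m) m)
  bound : 4 ^ suc D ≤ 32 * suc D * (C * C)
  bound = begin
    4 * (4 * 4 ^ (suc m + suc m))         ≤⟨ *-monoʳ-≤ 4 (*-monoʳ-≤ 4 (central-lower-bound m)) ⟩
    4 * (4 * (4 * suc m * (B * B)))       ≤⟨ *-monoʳ-≤ 4 (*-monoʳ-≤ 4 (*-monoʳ-≤ (4 * suc m) (*-mono-≤ B≤C B≤C))) ⟩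
    4 * (4 * (4 * suc m * (C * C)))       ≡⟨ regroup m (C * C) ⟩
    64 * suc m * (C * C)                  ≤⟨ *-monoˡ-≤ (C * C) (≤-trans (m≤m+n (64 * suc m) 64) (≤-reflexive (enlarge m))) ⟩
    32 * suc D * (C * C)                  ∎
    where
    open ≤-Reasoning
    regroup : ∀ m x → 4 * (4 * (4 * suc m * x)) ≡ 64 * suc m * x
    regroup = solve-∀
    enlarge : ∀ m → 64 * suc m + 64 ≡ 32 * suc (suc (suc m + suc m))
    enlarge = solve-∀

weight : ∀ {n} → Vec Bool n → ℕ
weight = countᵇ id

layer : ∀ n k → Fin (choose n k) → Vec Bool n
layer n       zero    _ = replicate n false
layer (suc n) (suc k) i with splitAt (choose n k) i
... | inj₁ j = true ∷ layer n k j
... | inj₂ j = false ∷ layer n (suc k) j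

weight-replicate-false : ∀ n → weight (replicate n false) ≡ 0
weight-replicate-false zero    = refl
weight-replicate-false (suc n) = weight-replicate-false n

weight-layer : ∀ n k i → weight (layer n k i) ≡ k
weight-layer n       zero    _ = weight-replicate-false n
weight-layer (suc n) (suc k) i with splitAt (choose n k) i
... | inj₁ j = cong suc (weight-layer n k j)
... | inj₂ j = weight-layer n (suc k) j

splitAt-injective : ∀ {m n} {i j : Fin (m + n)} → splitAt m i ≡ splitAt m j → i ≡ j
splitAt-injective {m} {n} {i} {j} eq = trans (sym (join-splitAt m n i)) (trans (cong (join m n) eq) (join-splitAt m n j))

layer-injective : ∀ n k {i j} → layer n k i ≡ layer n k j → i ≡ j
layer-injective zero    zero    {Fin.zero} {Fin.zero} _ = refl
layer-injective (suc n) zero    {Fin.zero} {Fin.zero} _ = refl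
layer-injective (suc n) (suc k) {i} {j} eq
  with splitAt (choose n k) i in split-i | splitAt (choose n k) j in split-j
... | inj₁ i′ | inj₁ j′ = splitAt-injective (trans split-i (trans (cong inj₁ (layer-injective n k (∷-injectiveʳ eq))) (sym split-j)))
... | inj₂ i′ | inj₂ j′ = splitAt-injective (trans split-i (trans (cong inj₂ (layer-injective n (suc k) (∷-injectiveʳ eq))) (sym split-j)))
... | inj₁ _  | inj₂ _  = contradiction (∷-injectiveˡ eq) λ ()
... | inj₂ _  | inj₁ _  = contradiction (∷-injectiveˡ eq) λ ()

weight<length⇒false : ∀ {n} (v : Vec Bool n) → weight v < n → Σ[ q ∈ Fin n ] lookup v q ≡ false
weight<length⇒false (false ∷ v) _         = Fin.zero , refl
weight<length⇒false (true ∷ v)  (s≤s w<n) with q , vq≡false ← weight<length⇒false v w<n = Fin.suc q , vq≡false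

weight≤⇒distinguishing : ∀ {n} (v w : Vec Bool n) → weight v ≤ weight w → v ≢ w →
  Σ[ q ∈ Fin n ] lookup v q ≡ false × lookup w q ≡ true
weight≤⇒distinguishing []          []          _        v≢w = contradiction refl v≢w
weight≤⇒distinguishing (false ∷ v) (true ∷ w)  _        _   = Fin.zero , refl , refl
weight≤⇒distinguishing (true ∷ v)  (true ∷ w)  (s≤s le) v≢w
  with q , eq ← weight≤⇒distinguishing v w le (v≢w ∘ cong (true ∷_)) = Fin.suc q , eq
weight≤⇒distinguishing (false ∷ v) (false ∷ w) le       v≢w
  with q , eq ← weight≤⇒distinguishing v w le (v≢w ∘ cong (false ∷_)) = Fin.suc q , eq
weight≤⇒distinguishing (true ∷ v)  (false ∷ w) le       _
  with q , eq ← weight≤⇒distinguishing v w (≤-trans (n≤1+n _) le) (<⇒≢ le ∘ cong weight) = Fin.suc q , eq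

sum-map-≡0 : ∀ {A : Set} (f : A → ℕ) xs → (∀ x → f x ≡ 0) → sum (List.map f xs) ≡ 0
sum-map-≡0 f List.[]       _  = refl
sum-map-≡0 f (x List.∷ xs) f≡0 = cong₂ _+_ (f≡0 x) (sum-map-≡0 f xs f≡0)

sum-map->0 : ∀ {A : Set} (f : A → ℕ) {xs x} → x ∈ xs → 0 < f x → 0 < sum (List.map f xs)
sum-map->0 f (here refl) fx>0 = ≤-trans fx>0 (m≤m+n _ _)
sum-map->0 f (there x∈xs) fx>0 = ≤-trans (sum-map->0 f x∈xs fx>0) (m≤n+m _ _)

any-≡false : ∀ {A : Set} (p : A → Bool) xs → (∀ x → p x ≡ false) → any p xs ≡ false
any-≡false p List.[]       _  = refl
any-≡false p (x List.∷ xs) p≡false rewrite p≡false x = any-≡false p xs p≡false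

any-≡true : ∀ {A : Set} (p : A → Bool) {xs x} → x ∈ xs → p x ≡ true → any p xs ≡ true
any-≡true p (here refl) px≡true rewrite px≡true = refl
any-≡true p {y List.∷ _} (there x∈xs) px≡true rewrite any-≡true p x∈xs px≡true with p y
... | true  = refl
... | false = refl

module _ {n d : ℕ} (v : OVInput n d → Bool) where

  inner-≡0 : ∀ j j′ → (∀ k → (v (j , k) ∧ v (j′ , k)) ≡ false) → inner v j j′ ≡ 0
  inner-≡0 j j′ disjoint = sum-map-≡0 _ (allFin d) λ k → cong (if_then 1 else 0) (disjoint k)

  inner->0 : ∀ j j′ k → (v (j , k) ∧ v (j′ , k)) ≡ true → 0 < inner v j j′
  inner->0 j j′ k common = sum-map->0 (λ k → if v (j , k) ∧ v (j′ , k) then 1 else 0) (∈-allFin k)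
                             (subst (λ b → 0 < (if b then 1 else 0)) (sym common) (s≤s z≤n))

  OV-≡true : ∀ j j′ → inner v j j′ ≡ 0 → OV n d v ≡ true
  OV-≡true j j′ orthogonal =
    any-≡true _ (∈-allFin j) (any-≡true _ (∈-allFin j′) (cong (_≡ᵇ 0) orthogonal))

  OV-≡false : (∀ j j′ → 0 < inner v j j′) → OV n d v ≡ false
  OV-≡false intersecting = any-≡false _ (allFin n) λ j → any-≡false _ (allFin n) λ j′ →
    positive (intersecting j j′)
    where
    positive : ∀ {x} → 0 < x → (x ≡ᵇ 0) ≡ false
    positive (s≤s _) = refl

-- Row i is free.  The restriction for S : Fin t → Bool puts w a into the a-th row
-- other than i when S a holds and all-ones into the remaining rows; its own row i is
-- never read, being overwritten by the substitution.
module HardInstance {n D t m : ℕ} (i : Fin (suc n)) (t≤n : t ≤ n) (t≤C : t ≤ choose D m) (m<D : m < D) where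

  word : Fin t → Vec Bool D
  word a = layer D m (inject≤ a t≤C)

  w x : Fin t → Vec Bool (suc D)
  w a = true ∷ word a
  x a = false ∷ map not (word a)

  ones : Vec Bool (suc D)
  ones = replicate (suc D) true

  otherRow : (Fin t → Bool) → Fin n → Vec Bool (suc D)
  otherRow S r with toℕ r <? t
  ... | yes r<t = if S (fromℕ< r<t) then w (fromℕ< r<t) else ones
  ... | no _    = ones

  rowOutside : (Fin t → Bool) → (j : Fin (suc n)) → Dec (i ≡ j) → Vec Bool (suc D)
  rowOutside S j (yes _)  = ones
  rowOutside S j (no i≢j) = otherRow S (punchOut i≢j)

  restriction : (Fin t → Bool) → OVInput (suc n) (suc D) → Bool
  restriction S (j , q) = lookup (rowOutside S j (i ≟ j)) q

  rowWith : (Fin t → Bool) → Fin t → (j : Fin (suc n)) → Dec (i ≡ j) → Vec Bool (suc D)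
  rowWith S a j (yes _) = x a
  rowWith S a j (no i≢j) = otherRow S (punchOut i≢j)

  -- Definitionally equal to Nechiporuk.plug (restriction S) y for the block of row i.
  substituted : (Fin t → Bool) → Vec Bool (suc D) → OVInput (suc n) (suc D) → Bool
  substituted S y (j , q) = if does (i ≟ j) then lookup y q else restriction S (j , q)

  substituted-row : ∀ S a j q → substituted S (x a) (j , q) ≡ lookup (rowWith S a j (i ≟ j)) q
  substituted-row S a j q = go (i ≟ j)
    where
    go : (i≟j : Dec (i ≡ j)) → (if does i≟j then lookup (x a) q else lookup (rowOutside S j i≟j) q) ≡ lookup (rowWith S a j i≟j) q
    go (yes _) = refl
    go (no _)  = refl

  data RowKind (S : Fin t → Bool) (a : Fin t) : Vec Bool (suc D) → Set where
    row-x    : RowKind S a (x a)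
    row-ones : RowKind S a ones
    row-w    : ∀ {b} → S b ≡ true → RowKind S a (w b)

  rowWith-kind : ∀ S a j (i≟j : Dec (i ≡ j)) → RowKind S a (rowWith S a j i≟j)
  rowWith-kind S a j (yes _)  = row-x
  rowWith-kind S a j (no i≢j) = otherRow-kind (punchOut i≢j)
    where
    chosen-kind : ∀ b B → S b ≡ B → RowKind S a (if B then w b else ones)
    chosen-kind b true  Sb≡true = row-w Sb≡true
    chosen-kind b false _       = row-ones
    otherRow-kind : ∀ r → RowKind S a (otherRow S r)
    otherRow-kind r with toℕ r <? t
    ... | yes r<t = chosen-kind (fromℕ< r<t) (S (fromℕ< r<t)) refl
    ... | no _    = row-ones

  x-nonzero : ∀ a → Σ[ q ∈ Fin (suc D) ] lookup (x a) q ≡ true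
  x-nonzero a with q , wordq≡false ← weight<length⇒false (word a) (subst (_< D) (sym (weight-layer D m _)) m<D) =
    Fin.suc q , trans (lookup-map q not (word a)) (cong not wordq≡false)

  x-meets-w : ∀ {a b} → a ≢ b → Σ[ q ∈ Fin (suc D) ] (lookup (x a) q ∧ lookup (w b) q) ≡ true
  x-meets-w {a} {b} a≢b
    with q , worda≡false , wordb≡true ← weight≤⇒distinguishing (word a) (word b)
           (≤-reflexive (trans (weight-layer D m _) (sym (weight-layer D m _))))
           (a≢b ∘ inject≤-injective _ _ a b ∘ layer-injective D m) =
    Fin.suc q , cong₂ _∧_ (trans (lookup-map q not (word a)) (cong not worda≡false)) wordb≡true

  x-orthogonal-w : ∀ a q → (lookup (x a) q ∧ lookup (w a) q) ≡ false
  x-orthogonal-w a Fin.zero    = refl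
  x-orthogonal-w a (Fin.suc q) rewrite lookup-map q not (word a) with lookup (word a) q
  ... | true  = refl
  ... | false = refl

  rows-meet : ∀ S a {u v} → S a ≡ false → RowKind S a u → RowKind S a v →
              Σ[ q ∈ Fin (suc D) ] (lookup u q ∧ lookup v q) ≡ true
  rows-meet S a Sa≡false row-x v-kind = x-meets v-kind
    where
    x-meets : ∀ {v} → RowKind S a v → Σ[ q ∈ Fin (suc D) ] (lookup (x a) q ∧ lookup v q) ≡ true
    x-meets row-x    with q , xq ← x-nonzero a = q , cong₂ _∧_ xq xq
    x-meets row-ones with q , xq ← x-nonzero a = q , cong₂ _∧_ xq (lookup-replicate q true)
    x-meets (row-w {b} Sb≡true) = x-meets-w λ { refl → contradiction (trans (sym Sa≡false) Sb≡true) λ () }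
  rows-meet S a {u} Sa≡false u-kind row-x with q , meet ← rows-meet S a Sa≡false row-x u-kind =
    q , trans (∧-comm (lookup u q) (lookup (x a) q)) meet
  rows-meet S a _ row-ones  row-ones  = Fin.zero , refl
  rows-meet S a _ row-ones  (row-w _) = Fin.zero , refl
  rows-meet S a _ (row-w _) row-ones  = Fin.zero , refl
  rows-meet S a _ (row-w _) (row-w _) = Fin.zero , refl

  slot : Fin t → Fin (suc n)
  slot a = punchIn i (inject≤ a t≤n)

  otherRow-inject≤ : ∀ S a → S a ≡ true → otherRow S (inject≤ a t≤n) ≡ w a
  otherRow-inject≤ S a Sa≡true with toℕ (inject≤ a t≤n) <? t
  ... | yes a<t rewrite toℕ-injective (trans (toℕ-fromℕ< a<t) (toℕ-inject≤ a t≤n)) | Sa≡true = refl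
  ... | no  a≮t = contradiction (subst (_< t) (sym (toℕ-inject≤ a t≤n)) (toℕ<n a)) a≮t

  rowWith-slot : ∀ S a → S a ≡ true → (i≟slot : Dec (i ≡ slot a)) → rowWith S a (slot a) i≟slot ≡ w a
  rowWith-slot S a _       (yes i≡slot) = contradiction (sym i≡slot) (punchInᵢ≢i i (inject≤ a t≤n))
  rowWith-slot S a Sa≡true (no i≢slot)  =
    trans (cong (otherRow S) (trans (punchOut-cong i refl) (punchOut-punchIn i))) (otherRow-inject≤ S a Sa≡true)

  rowWith-free : ∀ S a (i≟i : Dec (i ≡ i)) → rowWith S a i i≟i ≡ x a
  rowWith-free S a (yes _)  = refl
  rowWith-free S a (no i≢i) = contradiction refl i≢i

  OV-substituted : ∀ S a → OV (suc n) (suc D) (substituted S (x a)) ≡ S a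
  OV-substituted S a with S a in Sa
  ... | true = OV-≡true (substituted S (x a)) i (slot a) (inner-≡0 (substituted S (x a)) i (slot a) λ q → begin
    substituted S (x a) (i , q) ∧ substituted S (x a) (slot a , q)
      ≡⟨ cong₂ _∧_ (substituted-row S a i q) (substituted-row S a (slot a) q) ⟩
    lookup (rowWith S a i (i ≟ i)) q ∧ lookup (rowWith S a (slot a) (i ≟ slot a)) q
      ≡⟨ cong₂ (λ u v → lookup u q ∧ lookup v q) (rowWith-free S a (i ≟ i)) (rowWith-slot S a Sa (i ≟ slot a)) ⟩
    lookup (x a) q ∧ lookup (w a) q
      ≡⟨ x-orthogonal-w a q ⟩
    false ∎)
    where open ≡-Reasoning
  ... | false = OV-≡false (substituted S (x a)) λ j j′ →
    let q , meet = rows-meet S a Sa (rowWith-kind S a j (i ≟ j)) (rowWith-kind S a j′ (i ≟ j′))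
    in  inner->0 (substituted S (x a)) j j′ q (trans (cong₂ _∧_ (substituted-row S a j q) (substituted-row S a j′ q)) meet)

inRow : ∀ {n d} → Fin n → OVInput n d → Bool
inRow i (j , _) = does (i ≟ j)

entry : ∀ {n d} → OVInput n d → Vec Bool d → Bool
entry (_ , q) y = lookup y q

∑-zero : ∀ n → ∑ {n} (λ _ → 0) ≡ 0
∑-zero zero    = refl
∑-zero (suc n) = ∑-zero n

∑-indicator : ∀ {n} (j : Fin n) → ∑ (λ i → if does (i ≟ j) then 1 else 0) ≡ 1
∑-indicator {suc n} Fin.zero    = cong suc (∑-zero n)
∑-indicator {suc n} (Fin.suc j) = ∑-indicator j

module Rows {n d c : ℕ} (i : Fin n) = Nechiporuk (inRow {n} {d} i) entry c

mutual
  rowLeaves≤size : ∀ {n d c} (F : Formula (OVInput n d) c) → ∑ (λ i → Rows.blockLeaves i F) ≤ size F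
  rowLeaves≤size (var (j , q))     = ≤-reflexive (∑-indicator j)
  rowLeaves≤size {n} (const b)     = ≤-trans (≤-reflexive (∑-zero n)) z≤n
  rowLeaves≤size (gate k _ g fs)   = m≤n⇒m≤1+n (rowLeaves≤sizes fs)

  rowLeaves≤sizes : ∀ {n d c k} (fs : Vec (Formula (OVInput n d) c) k) → ∑ (λ i → Rows.blockLeavesᵛ i fs) ≤ sizes fs
  rowLeaves≤sizes {n} []   = ≤-reflexive (∑-zero n)
  rowLeaves≤sizes (f ∷ fs) = ≤-trans (≤-reflexive (∑-distrib-+ (λ i → Rows.blockLeaves i f) (λ i → Rows.blockLeavesᵛ i fs)))
                                     (+-mono-≤ (rowLeaves≤size f) (rowLeaves≤sizes fs))

funToFin-cong : ∀ {m n} {f g : Fin m → Fin n} → (∀ a → f a ≡ g a) → funToFin f ≡ funToFin g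
funToFin-cong {zero}  _   = refl
funToFin-cong {suc m} f≗g = cong₂ combine (f≗g Fin.zero) (funToFin-cong (f≗g ∘ Fin.suc))

subset : ∀ {t} → Fin (2 ^ t) → Fin t → Bool
subset k = Inverse.to 2↔Bool ∘ finToFun k

subset-injective : ∀ {t} {k k′ : Fin (2 ^ t)} → (∀ (a : Fin t) → subset k a ≡ subset k′ a) → k ≡ k′
subset-injective {t} {k} {k′} same = begin
  k                               ≡⟨ funToFin-finToFin {t} {2} k ⟨
  funToFin (finToFun {2} {t} k)   ≡⟨ funToFin-cong (λ a → to-injective (same a)) ⟩
  funToFin (finToFun {2} {t} k′)  ≡⟨ funToFin-finToFin {t} {2} k′ ⟩
  k′                              ∎
  where
  open ≡-Reasoning
  to-injective : ∀ {x y} → Inverse.to 2↔Bool x ≡ Inverse.to 2↔Bool y → x ≡ y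
  to-injective {x} {y} eq = trans (sym (Inverse.strictlyInverseʳ 2↔Bool x))
                              (trans (cong (Inverse.from 2↔Bool) eq) (Inverse.strictlyInverseʳ 2↔Bool y))

2^m≤2^n⇒m≤n : ∀ {m n} → 2 ^ m ≤ 2 ^ n → m ≤ n
2^m≤2^n⇒m≤n le = ≮⇒≥ λ n<m → <⇒≱ (^-monoʳ-< 2 (s≤s (s≤s z≤n)) n<m) le

exponent-bound : ∀ c t l → 2 ^ t ≤ 4 * #BoolFun c ^ (2 * l) → t ≤ 2 + 2 ^ c * 2 * l
exponent-bound c t l le = 2^m≤2^n⇒m≤n (≤-trans le (≤-reflexive (begin
  4 * #BoolFun c ^ (2 * l)          ≡⟨ cong (λ z → 4 * z ^ (2 * l)) (#BoolFun≡2^2^k c) ⟩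
  2 ^ 2 * (2 ^ 2 ^ c) ^ (2 * l)     ≡⟨ cong (2 ^ 2 *_) (^-*-assoc 2 (2 ^ c) (2 * l)) ⟩
  2 ^ 2 * 2 ^ (2 ^ c * (2 * l))     ≡⟨ ^-distribˡ-+-* 2 2 (2 ^ c * (2 * l)) ⟨
  2 ^ (2 + 2 ^ c * (2 * l))         ≡⟨ cong (λ z → 2 ^ (2 + z)) (*-assoc (2 ^ c) 2 l) ⟨
  2 ^ (2 + 2 ^ c * 2 * l)           ∎)))
  where open ≡-Reasoning

row-bound : ∀ {n D t m c} (F : Formula (OVInput (suc n) (suc D)) c) → Computes F (OV (suc n) (suc D)) →
            (i : Fin (suc n)) → t ≤ n → t ≤ choose D m → m < D → t ≤ 2 + 2 ^ c * 2 * Rows.blockLeaves i F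
row-bound {n} {D} {t} {c = c} F computes i t≤n t≤C m<D =
  exponent-bound c t (Rows.blockLeaves i F) (Rows.distinctSubfunctions≤ i F (restriction ∘ subset {t}) distinct)
  where
  open HardInstance i t≤n t≤C m<D
  distinct : ∀ (k k′ : Fin (2 ^ t)) → (∀ y → eval F (substituted (subset k) y) ≡ eval F (substituted (subset k′) y)) → k ≡ k′
  distinct k k′ same-subfunction = subset-injective {t} λ a → begin
    subset k a                                          ≡⟨ OV-substituted (subset k) a ⟨
    OV (suc n) (suc D) (substituted (subset k) (x a))   ≡⟨ computes _ ⟨
    eval F (substituted (subset k) (x a))               ≡⟨ same-subfunction (x a) ⟩
    eval F (substituted (subset k′) (x a))              ≡⟨ computes _ ⟩
    OV (suc n) (suc D) (substituted (subset k′) (x a))  ≡⟨ OV-substituted (subset k′) a ⟩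
    subset k′ a                                         ∎
    where open ≡-Reasoning

∑-affine-bound : ∀ {n} t a (f : Fin n → ℕ) → (∀ i → t ≤ 2 + a * f i) → n * t ≤ n * 2 + a * ∑ f
∑-affine-bound {zero}  t a f _     = z≤n
∑-affine-bound {suc n} t a f bound = begin
  t + n * t                                  ≤⟨ +-mono-≤ (bound Fin.zero) (∑-affine-bound t a (f ∘ Fin.suc) (bound ∘ Fin.suc)) ⟩
  (2 + a * f Fin.zero) + (n * 2 + a * rest)  ≡⟨ regroup n a (f Fin.zero) rest ⟩
  (2 + n * 2) + a * (f Fin.zero + rest)      ∎
  where
  open ≤-Reasoning
  rest = ∑ (f ∘ Fin.suc)
  regroup : ∀ n a x y → (2 + a * x) + (n * 2 + a * y) ≡ (2 + n * 2) + a * (x + y)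
  regroup = solve-∀

OV-affine-bound : ∀ {n D t m c} (F : Formula (OVInput (suc n) (suc D)) c) → Computes F (OV (suc n) (suc D)) →
                  t ≤ n → t ≤ choose D m → m < D → suc n * t ≤ suc n * 2 + 2 ^ c * 2 * size F
OV-affine-bound {n} {t = t} {c = c} F computes t≤n t≤C m<D = begin
  suc n * t                                         ≤⟨ ∑-affine-bound t a (λ i → Rows.blockLeaves i F) (λ i → row-bound F computes i t≤n t≤C m<D) ⟩
  suc n * 2 + a * ∑ (λ i → Rows.blockLeaves i F)    ≤⟨ +-monoʳ-≤ (suc n * 2) (*-monoʳ-≤ a (rowLeaves≤size F)) ⟩
  suc n * 2 + a * size F                            ∎
  where
  open ≤-Reasoning
  a = 2 ^ c * 2

absorb-linear : ∀ n t s → 4 ≤ t → n * t ≤ n * 2 + s → n * t ≤ 2 * s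
absorb-linear n t s 4≤t le = +-cancelˡ-≤ (n * t) _ _ (begin
  n * t + n * t                 ≤⟨ +-mono-≤ le le ⟩
  (n * 2 + s) + (n * 2 + s)     ≡⟨ regroup n s ⟩
  n * 4 + 2 * s                 ≤⟨ +-monoˡ-≤ (2 * s) (*-monoʳ-≤ n 4≤t) ⟩
  n * t + 2 * s                 ∎)
  where
  open ≤-Reasoning
  regroup : ∀ n s → (n * 2 + s) + (n * 2 + s) ≡ n * 4 + 2 * s
  regroup = solve-∀

quadratic-branch : ∀ n s → 1 ≤ n → suc n * n ≤ 2 * s → suc n * suc n ≤ 12 * s
quadratic-branch n s 1≤n le = begin
  suc n * suc n          ≡⟨ split n ⟩
  suc n * n + suc n * 1  ≤⟨ +-monoʳ-≤ (suc n * n) (*-monoʳ-≤ (suc n) 1≤n) ⟩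
  suc n * n + suc n * n  ≤⟨ +-mono-≤ le le ⟩
  2 * s + 2 * s          ≤⟨ ≤-reflexive (double s) ⟩
  4 * s                  ≤⟨ *-monoˡ-≤ s (m≤m+n 4 8) ⟩
  12 * s                 ∎
  where
  open ≤-Reasoning
  split : ∀ n → suc n * suc n ≡ suc n * n + suc n * 1
  split = solve-∀
  double : ∀ s → 2 * s + 2 * s ≡ 4 * s
  double = solve-∀

exponential-branch : ∀ N P C d s → P * P ≤ 32 * d * (C * C) → N * C ≤ 2 * s → (N * P) ^ 2 ≤ (12 * s) ^ 2 * d
exponential-branch N P C d s P²≤ NC≤ = begin
  (N * P) ^ 2                  ≡⟨ square-product N P ⟩
  (N * N) * (P * P)            ≤⟨ *-monoʳ-≤ (N * N) (≤-trans P²≤ (*-monoˡ-≤ (C * C) (*-monoˡ-≤ d (m≤m+n 32 4)))) ⟩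
  (N * N) * (36 * d * (C * C)) ≡⟨ regroup N C d ⟩
  (6 * (N * C)) ^ 2 * d        ≤⟨ *-monoˡ-≤ d (^-monoˡ-≤ 2 (*-monoʳ-≤ 6 NC≤)) ⟩
  (6 * (2 * s)) ^ 2 * d        ≡⟨ cong (λ z → z ^ 2 * d) (*-assoc 6 2 s) ⟨
  (12 * s) ^ 2 * d             ∎
  where
  open ≤-Reasoning
  square-product : ∀ x y → (x * y) * ((x * y) * 1) ≡ (x * x) * (y * y)
  square-product = solve-∀
  regroup : ∀ x y z → (x * x) * (36 * z * (y * y)) ≡ (6 * (x * y)) * ((6 * (x * y)) * 1) * z
  regroup = solve-∀

4^n≡2^n*2^n : ∀ n → 4 ^ n ≡ 2 ^ n * 2 ^ n
4^n≡2^n*2^n zero    = refl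
4^n≡2^n*2^n (suc n) = trans (cong (4 *_) (4^n≡2^n*2^n n)) (regroup (2 ^ n))
  where
  regroup : ∀ x → 4 * (x * x) ≡ (2 * x) * (2 * x)
  regroup = solve-∀

OV-lower-bound : ∀ {n D c} (F : Formula (OVInput n (suc D)) c) → Computes F (OV n (suc D)) → 6 ≤ n → 5 ≤ D →
  n * n ≤ 12 * (2 ^ c * 2) * size F ⊎ (n * 2 ^ suc D) ^ 2 ≤ (12 * (2 ^ c * 2) * size F) ^ 2 * suc D
OV-lower-bound {suc n} {D} {c} F computes (s≤s 5≤n) 5≤D
  with m , m<D , D≤C , 4^d≤ ← middle-binomial D (≤-trans (s≤s (s≤s z≤n)) 5≤D)
  with n ≤? choose D m
... | yes n≤C = inj₁ (subst (suc n * suc n ≤_) (sym (*-assoc 12 a S))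
      (quadratic-branch n (a * S) (≤-trans (s≤s z≤n) 5≤n)
        (absorb-linear (suc n) n (a * S) (≤-trans (n≤1+n 4) 5≤n) (OV-affine-bound F computes ≤-refl n≤C m<D))))
  where
  a = 2 ^ c * 2
  S = size F
... | no  n≰C = inj₂ (subst (λ z → (suc n * 2 ^ suc D) ^ 2 ≤ z ^ 2 * suc D) (sym (*-assoc 12 a S))
      (exponential-branch (suc n) (2 ^ suc D) C (suc D) (a * S)
        (subst (_≤ 32 * suc D * (C * C)) (4^n≡2^n*2^n (suc D)) 4^d≤)
        (absorb-linear (suc n) C (a * S) (≤-trans (n≤1+n 4) (≤-trans 5≤D D≤C))
          (OV-affine-bound F computes (≰⇒≥ n≰C) ≤-refl m<D))))
  where
  a = 2 ^ c * 2
  S = size F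
  C = choose D m

1≤⌊log₂⌋ : ∀ {d} → 2 ≤ d → 1 ≤ ⌊log₂ d ⌋
1≤⌊log₂⌋ {d} 2≤d = subst (_≤ ⌊log₂ d ⌋) (⌊log₂[2^n]⌋≡n 1) (⌊log₂⌋-mono-≤ 2≤d)

-- OV-lower-bound needs no log d factor; ⌊log₂ d⌋ ≥ 1 only weakens it here.
theorem1p1 : (c : ℕ) → 1 ≤ c →
    Σ ℕ (λ p → Σ ℕ (λ q → 1 ≤ p × 1 ≤ q × Σ ℕ (λ N →
      (n d : ℕ) → N ≤ n → N ≤ d →
      (F : Formula (OVInput n d) c) → Computes F (OV n d) →
        (p * (n * n) ≤ q * size F * ⌊log₂ d ⌋)
        ⊎ ((p * n * 2 ^ d) ^ 2 ≤ (q * size F * ⌊log₂ d ⌋) ^ 2 * d))))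
theorem1p1 c _ = 1 , q , ≤-refl , *-mono-≤ {1} {12} (s≤s z≤n) (*-mono-≤ (m^n>0 2 c) (s≤s z≤n)) , 6 , bound
  where
  q = 12 * (2 ^ c * 2)
  bound : (n d : ℕ) → 6 ≤ n → 6 ≤ d → (F : Formula (OVInput n d) c) → Computes F (OV n d) →
          (1 * (n * n) ≤ q * size F * ⌊log₂ d ⌋) ⊎ ((1 * n * 2 ^ d) ^ 2 ≤ (q * size F * ⌊log₂ d ⌋) ^ 2 * d)
  bound n (suc D) 6≤n (s≤s 5≤D) F computes = Sum.map
    (λ quadratic → subst (_≤ q * size F * lg) (sym (*-identityˡ (n * n))) (≤-trans quadratic qS≤qS·lg))
    (λ exponential → subst (λ z → (z * 2 ^ suc D) ^ 2 ≤ (q * size F * lg) ^ 2 * suc D) (sym (*-identityˡ n))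
                       (≤-trans exponential (*-monoˡ-≤ (suc D) (^-monoˡ-≤ 2 qS≤qS·lg))))
    (OV-lower-bound F computes 6≤n 5≤D)
    where
    lg = ⌊log₂ suc D ⌋
    qS≤qS·lg : q * size F ≤ q * size F * lg
    qS≤qS·lg = m≤m*n (q * size F) lg {{>-nonZero (1≤⌊log₂⌋ (s≤s (≤-trans (s≤s z≤n) 5≤D)))}}
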